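{- Let $n\in\mathbb{N}$ and $\mathbf{x}\in\{0,1\}^n\setminus\{\mathbf{e}^n\}$, and let $k\in[n]$ be the unique index such that either $\partial_kF_n(\mathbf{x})>0$ and $x_k=0$, or $\partial_kF_n(\mathbf{x})<0$ and $x_k=1$. Then $\partial_kF_n(\mathbf{x})=\partial_kF_n(\mathbf{x}+\mu\mathbf{e}^k)$ for all $\mu\in\mathbb{R}$.
   Context: For $n\in\mathbb{N}$ and $\mathbf{x}=(x_1,\dots,x_n)^\top\in\mathbb{R}^n$, set $x_0:=1$, $\alpha_{n,n+1}(\mathbf{x})=0$, and for $i\in[n]=\{1,\dots,n\}$: $\alpha_{n,i}(\mathbf{x})=x_i+(1-2x_i)\alpha_{n,i+1}(\mathbf{x})$ and $\beta_{n,i}(\mathbf{x})=2^i(x_i-x_i^2)\bigl(1-x_{i-1}+\sum_{j=1}^{i-2}x_j\bigr)$. Define $F_n(\mathbf{x})=\sum_{i=1}^n\bigl(2^{i-1}\alpha_{n,i}(\mathbf{x})-\beta_{n,i}(\mathbf{x})\bigr)$. $\mathbf{e}^k$ is the $k$-th unit vector. (The existence and uniqueness of such $k$ for every $\mathbf{x}\in\{0,1\}^n\setminus\{\mathbf{e}^n\}$ is a separate result of the paper.)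
   Formalization: The scalar μ ranges over the rationals instead of ℝ, and the partial derivatives $\partial_kF_n$ are evaluated over ℚ. -}

module Defs where

open import Data.Nat as ℕ using (ℕ; zero; suc; _∸_; _^_)
open import Data.Fin as Fin using (Fin; toℕ; fromℕ<)
open import Data.Integer using (+_)
open import Data.Rational using (ℚ; 0ℚ; 1ℚ; _+_; _*_; -_; _/_)
open import Data.Bool using (Bool; true; false; if_then_else_)
open import Relation.Nullary using (yes; no)

-- Polynomial expressions in the variables x_1,…,x_n (variable x_i is 'var' at Fin index i-1)
-- with rational coefficients.
data Poly (n : ℕ) : Set where
  con  : ℚ → Poly n
  var  : Fin n → Poly n
  _⊕_  : Poly n → Poly n → Poly n
  _⊗_  : Poly n → Poly n → Poly n
  ⊖_   : Poly n → Poly n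

infixl 6 _⊕_ _⊝_
infixl 7 _⊗_
infix 8 ⊖_

_⊝_ : ∀ {n} → Poly n → Poly n → Poly n
p ⊝ q = p ⊕ (⊖ q)

eval : ∀ {n} → (Fin n → ℚ) → Poly n → ℚ
eval x (con c) = c
eval x (var j) = x j
eval x (p ⊕ q) = eval x p + eval x q
eval x (p ⊗ q) = eval x p * eval x q
eval x (⊖ p)   = - eval x p

-- Formal partial derivative with respect to the k-th variable
-- (for polynomials this coincides with the analytic partial derivative).
∂ : ∀ {n} → Fin n → Poly n → Poly n
∂ k (con c) = con 0ℚ
∂ k (var j) with j Fin.≟ k
... | yes _ = con 1ℚ
... | no _  = con 0ℚ
∂ k (p ⊕ q) = ∂ k p ⊕ ∂ k q
∂ k (p ⊗ q) = (∂ k p ⊗ q) ⊕ (p ⊗ ∂ k q)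
∂ k (⊖ p)   = ⊖ ∂ k p

cℕ : ∀ {n} → ℕ → Poly n
cℕ m = con (+ m / 1)

-- X i = x_i for 1 ≤ i ≤ n, with the convention X 0 = x_0 = 1
-- (indices > n never occur below).
X : ∀ {n} → ℕ → Poly n
X zero = con 1ℚ
X {n} (suc j) with j ℕ.<? n
... | yes p = var (fromℕ< p)
... | no _  = con 0ℚ

-- αAux m i : the recursion α_{n,i} = x_i + (1 - 2 x_i) α_{n,i+1}, unfolded m times, ending in α_{n,n+1} = 0
αAux : ∀ {n} → ℕ → ℕ → Poly n
αAux zero i = con 0ℚ
αAux (suc m) i = X i ⊕ ((cℕ 1 ⊝ cℕ 2 ⊗ X i) ⊗ αAux m (suc i))

α : (n : ℕ) → ℕ → Poly n
α n i = αAux (suc n ∸ i) i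

ΣX : ∀ {n} → ℕ → Poly n
ΣX zero = con 0ℚ
ΣX (suc m) = ΣX m ⊕ X (suc m)

β : (n : ℕ) → ℕ → Poly n
β n i = cℕ (2 ^ i) ⊗ (X i ⊝ X i ⊗ X i) ⊗ (cℕ 1 ⊝ X (i ∸ 1) ⊕ ΣX (i ∸ 2))

FSum : (n : ℕ) → ℕ → Poly n
FSum n zero = con 0ℚ
FSum n (suc m) = FSum n m ⊕ (cℕ (2 ^ m) ⊗ α n (suc m) ⊝ β n (suc m))

F : (n : ℕ) → Poly n
F n = FSum n n

∂F : (n : ℕ) → Fin n → (Fin n → ℚ) → ℚ
∂F n k x = eval x (∂ k (F n))

toℚ : ∀ {n} → (Fin n → Bool) → Fin n → ℚ
toℚ b j = if b j then 1ℚ else 0ℚ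

unit : ∀ {n} → Fin n → Fin n → ℚ
unit k j with j Fin.≟ k
... | yes _ = 1ℚ
... | no _  = 0ℚ

eLastBool : (n : ℕ) → Fin n → Bool
eLastBool n j = toℕ j ℕ.≡ᵇ (n ∸ 1)

{-# OPTIONS --safe #-}
-- Of the summands of F_n, only β_{n,k} = 2^k (x_k - x_k²) c_k, with
-- c_k = 1 - x_{k-1} + Σ_{j ≤ k-2} x_j, is not affine in x_k: the α_{n,i} are
-- multilinear and the other β_{n,i} are affine in x_k. Hence ∂_k F_n does not
-- depend on x_k once c_k = 0, and it remains to show c_k(x) = 0.
-- At a Boolean point x, c_k(x) is 0 or at least 1, every ∂_k α_{n,i}(x) lies in
-- {-1, 0, 1} and vanishes for i > k, and ∂_k β_{n,i}(x) = 0 for i ≠ k, so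
-- ∂_k F_n(x) = A - 2^k (1 - 2 x_k) c_k(x) with |A| < 2^k. If c_k(x) ≥ 1, the sign
-- of ∂_k F_n(x) is therefore that of 2 x_k - 1, contradicting the choice of k.

module Submission where

open import Defs
open import Data.Nat using (ℕ)
open import Data.Fin using (Fin)
open import Data.Bool using (Bool; true; false)
open import Data.Rational using (ℚ; 0ℚ; _+_; _*_; _<_; _>_)
open import Data.Product using (_×_)
open import Data.Sum using (_⊎_)
open import Relation.Nullary using (¬_)
open import Relation.Binary.PropositionalEquality using (_≡_)

open import Algebra.Properties.Group using (⁻¹-involutive)
open import Data.Bool using (if_then_else_)
open import Data.Empty using (⊥-elim)
open import Data.Fin as Fin using (toℕ; fromℕ<)
import Data.Fin.Properties as Fin
open import Data.Integer as ℤ using (+_)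
import Data.Integer.Properties as ℤ
open import Data.Nat as ℕ using (zero; suc; _∸_; _^_; s≤s)
import Data.Nat.Properties as ℕ
open import Data.Product using (_,_; proj₁; proj₂)
open import Data.Rational using (1ℚ; -_; _-_; _/_; _≤_; toℚᵘ; nonNegative)
open import Data.Rational.Properties
open import Data.Rational.Solver using (module +-*-Solver)
import Data.Rational.Unnormalised as ℚᵘ
import Data.Rational.Unnormalised.Properties as ℚᵘ
open import Data.Sum using (inj₁; inj₂)
open import Relation.Nullary using (yes; no)
open import Relation.Nullary.Decidable using (toWitness)
open import Relation.Binary.PropositionalEquality
  using (refl; sym; trans; cong; cong₂; subst; subst₂; _≢_; module ≡-Reasoning)

fromℕ : ℕ → ℚ
fromℕ m = + m / 1

fromℕ-+ : ∀ a b → fromℕ a + fromℕ b ≡ fromℕ (a ℕ.+ b)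
fromℕ-+ a b = toℚᵘ-injective (begin
  toℚᵘ (fromℕ a + fromℕ b)            ≈⟨ toℚᵘ-homo-+ (fromℕ a) (fromℕ b) ⟩
  toℚᵘ (fromℕ a) ℚᵘ.+ toℚᵘ (fromℕ b)  ≈⟨ ℚᵘ.+-cong (toℚᵘ-fromℚᵘ [ a ]) (toℚᵘ-fromℚᵘ [ b ]) ⟩
  [ a ] ℚᵘ.+ [ b ]                    ≈⟨ ℚᵘ.*≡* integer-sum ⟩
  [ a ℕ.+ b ]                         ≈⟨ toℚᵘ-fromℚᵘ [ a ℕ.+ b ] ⟨
  toℚᵘ (fromℕ (a ℕ.+ b))              ∎)
  where
  open ℚᵘ.≃-Reasoning
  [_] : ℕ → ℚᵘ.ℚᵘ
  [ m ] = ℚᵘ.mkℚᵘ (+ m) 0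
  integer-sum : (+ a ℤ.* ℤ.1ℤ ℤ.+ + b ℤ.* ℤ.1ℤ) ℤ.* ℤ.1ℤ ≡ + (a ℕ.+ b) ℤ.* ℤ.1ℤ
  integer-sum = trans (ℤ.*-identityʳ _)
    (trans (cong₂ ℤ._+_ (ℤ.*-identityʳ (+ a)) (ℤ.*-identityʳ (+ b)))
    (trans (sym (ℤ.pos-+ a b)) (sym (ℤ.*-identityʳ _))))

fromℕ-2^suc : ∀ m → fromℕ (2 ^ suc m) ≡ fromℕ (2 ^ m) + fromℕ (2 ^ m)
fromℕ-2^suc m = begin
  fromℕ (2 ^ suc m)              ≡⟨ cong (λ t → fromℕ (2 ^ m ℕ.+ t)) (ℕ.*-identityˡ (2 ^ m)) ⟩
  fromℕ (2 ^ m ℕ.+ 2 ^ m)        ≡⟨ fromℕ-+ (2 ^ m) (2 ^ m) ⟨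
  fromℕ (2 ^ m) + fromℕ (2 ^ m)  ∎
  where open ≡-Reasoning

fromℕ-nonNeg : ∀ m → 0ℚ ≤ fromℕ m
fromℕ-nonNeg m = nonNegative⁻¹ (fromℕ m) {{normalize-nonNeg m 1}}

-- Independence of x_k

data Free {n} (k : Fin n) : Poly n → Set where
  con : ∀ c → Free k (con c)
  var : ∀ {j} → j ≢ k → Free k (var j)
  _⊕_ : ∀ {p q} → Free k p → Free k q → Free k (p ⊕ q)
  _⊗_ : ∀ {p q} → Free k p → Free k q → Free k (p ⊗ q)
  ⊖_  : ∀ {p} → Free k p → Free k (⊖ p)

AgreeOff : ∀ {n} → Fin n → (x y : Fin n → ℚ) → Set
AgreeOff k x y = ∀ j → j ≢ k → x j ≡ y j

unit-off : ∀ {n} {k j : Fin n} → j ≢ k → unit k j ≡ 0ℚ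
unit-off {k = k} {j} j≢k with j Fin.≟ k
... | yes j≡k = ⊥-elim (j≢k j≡k)
... | no _    = refl

agreeOff-+unit : ∀ {n} (k : Fin n) (x : Fin n → ℚ) μ → AgreeOff k x (λ j → x j + μ * unit k j)
agreeOff-+unit k x μ j j≢k = sym (begin
  x j + μ * unit k j  ≡⟨ cong (λ u → x j + μ * u) (unit-off j≢k) ⟩
  x j + μ * 0ℚ        ≡⟨ cong (λ t → x j + t) (*-zeroʳ μ) ⟩
  x j + 0ℚ            ≡⟨ +-identityʳ (x j) ⟩
  x j                 ∎)
  where open ≡-Reasoning

module _ {n : ℕ} {k : Fin n} where

  eval-free : ∀ {x y p} → AgreeOff k x y → Free k p → eval x p ≡ eval y p
  eval-free x≈y (con c)   = refl
  eval-free x≈y (var j≢k) = x≈y _ j≢k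
  eval-free x≈y (f ⊕ g)   = cong₂ _+_ (eval-free x≈y f) (eval-free x≈y g)
  eval-free x≈y (f ⊗ g)   = cong₂ _*_ (eval-free x≈y f) (eval-free x≈y g)
  eval-free x≈y (⊖ f)     = cong -_ (eval-free x≈y f)

  ∂-free : ∀ z {p} → Free k p → eval z (∂ k p) ≡ 0ℚ
  ∂-free z (con c) = refl
  ∂-free z (var {j} j≢k) with j Fin.≟ k
  ... | yes j≡k = ⊥-elim (j≢k j≡k)
  ... | no _    = refl
  ∂-free z (f ⊕ g) = cong₂ _+_ (∂-free z f) (∂-free z g)
  ∂-free z (_⊗_ {p} {q} f g) = cong₂ _+_
    (trans (cong (_* eval z q) (∂-free z f)) (*-zeroˡ (eval z q)))
    (trans (cong (eval z p *_) (∂-free z g)) (*-zeroʳ (eval z p)))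
  ∂-free z (⊖ f) = cong -_ (∂-free z f)

  ∂-⊗-freeˡ : ∀ z {p q} → Free k p → eval z (∂ k (p ⊗ q)) ≡ eval z p * eval z (∂ k q)
  ∂-⊗-freeˡ z {p} {q} f = begin
    ∂P * Q + P * ∂Q  ≡⟨ cong (λ t → t * Q + P * ∂Q) (∂-free z f) ⟩
    0ℚ * Q + P * ∂Q  ≡⟨ cong (_+ P * ∂Q) (*-zeroˡ Q) ⟩
    0ℚ + P * ∂Q      ≡⟨ +-identityˡ (P * ∂Q) ⟩
    P * ∂Q           ∎
    where
    open ≡-Reasoning
    P = eval z p; Q = eval z q; ∂P = eval z (∂ k p); ∂Q = eval z (∂ k q)

  ∂-⊗-freeʳ : ∀ z {p q} → Free k q → eval z (∂ k (p ⊗ q)) ≡ eval z (∂ k p) * eval z q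
  ∂-⊗-freeʳ z {p} {q} f = begin
    ∂P * Q + P * ∂Q  ≡⟨ cong (λ t → ∂P * Q + P * t) (∂-free z f) ⟩
    ∂P * Q + P * 0ℚ  ≡⟨ cong (λ t → ∂P * Q + t) (*-zeroʳ P) ⟩
    ∂P * Q + 0ℚ      ≡⟨ +-identityʳ (∂P * Q) ⟩
    ∂P * Q           ∎
    where
    open ≡-Reasoning
    P = eval z p; Q = eval z q; ∂P = eval z (∂ k p); ∂Q = eval z (∂ k q)

  ∂-var-free : ∀ j → Free k (∂ k (var j))
  ∂-var-free j with j Fin.≟ k
  ... | yes _ = con _
  ... | no _  = con _

  ∂-X-free : ∀ i → Free k (∂ k (X {n} i))
  ∂-X-free zero = con _
  ∂-X-free (suc j) with j ℕ.<? n
  ... | yes j<n = ∂-var-free (fromℕ< j<n)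
  ... | no _    = con _

record ∂-Agrees {n} (k : Fin n) (x y : Fin n → ℚ) (p : Poly n) : Set where
  constructor ∂-agrees
  field ∂-agreement : eval x (∂ k p) ≡ eval y (∂ k p)
open ∂-Agrees

module _ {n : ℕ} {k : Fin n} {x y : Fin n → ℚ} (x≈y : AgreeOff k x y) where

  ∂-agrees-X : ∀ i → ∂-Agrees k x y (X i)
  ∂-agrees-X i = ∂-agrees (eval-free x≈y (∂-X-free i))

  ∂-agrees-⊕ : ∀ {p q} → ∂-Agrees k x y p → ∂-Agrees k x y q → ∂-Agrees k x y (p ⊕ q)
  ∂-agrees-⊕ (∂-agrees e₁) (∂-agrees e₂) = ∂-agrees (cong₂ _+_ e₁ e₂)

  ∂-agrees-⊖ : ∀ {p} → ∂-Agrees k x y p → ∂-Agrees k x y (⊖ p)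
  ∂-agrees-⊖ (∂-agrees e) = ∂-agrees (cong -_ e)

  ∂-agrees-⊗-freeˡ : ∀ {p q} → Free k p → ∂-Agrees k x y q → ∂-Agrees k x y (p ⊗ q)
  ∂-agrees-⊗-freeˡ {p} {q} f (∂-agrees e) = ∂-agrees (begin
    eval x (∂ k (p ⊗ q))       ≡⟨ ∂-⊗-freeˡ x {q = q} f ⟩
    eval x p * eval x (∂ k q)  ≡⟨ cong₂ _*_ (eval-free x≈y f) e ⟩
    eval y p * eval y (∂ k q)  ≡⟨ ∂-⊗-freeˡ y {q = q} f ⟨
    eval y (∂ k (p ⊗ q))       ∎)
    where open ≡-Reasoning

  ∂-agrees-⊗-freeʳ : ∀ {p q} → ∂-Agrees k x y p → Free k q → ∂-Agrees k x y (p ⊗ q)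
  ∂-agrees-⊗-freeʳ {p} {q} (∂-agrees e) f = ∂-agrees (begin
    eval x (∂ k (p ⊗ q))       ≡⟨ ∂-⊗-freeʳ x {p = p} f ⟩
    eval x (∂ k p) * eval x q  ≡⟨ cong₂ _*_ e (eval-free x≈y f) ⟩
    eval y (∂ k p) * eval y q  ≡⟨ ∂-⊗-freeʳ y {p = p} f ⟨
    eval y (∂ k (p ⊗ q))       ∎)
    where open ≡-Reasoning

-- β n i is definitionally β-bump i ⊗ β-factor i
β-bump : ∀ {n} → ℕ → Poly n
β-bump i = cℕ (2 ^ i) ⊗ (X i ⊝ X i ⊗ X i)

β-factor : ∀ {n} → ℕ → Poly n
β-factor i = cℕ 1 ⊝ X (i ∸ 1) ⊕ ΣX (i ∸ 2)

Bit : ℚ → Set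
Bit q = q ≡ 0ℚ ⊎ q ≡ 1ℚ

Trit : ℚ → Set
Trit q = q ≡ - 1ℚ ⊎ q ≡ 0ℚ ⊎ q ≡ 1ℚ

ZeroOr≥1 : ℚ → Set
ZeroOr≥1 q = q ≡ 0ℚ ⊎ 1ℚ ≤ q

-- (-1)^a for a bit a; eval x (cℕ 1 ⊝ cℕ 2 ⊗ p) is definitionally sgn (eval x p)
sgn : ℚ → ℚ
sgn a = 1ℚ - fromℕ 2 * a

bit-idempotent : ∀ {a} → Bit a → a - a * a ≡ 0ℚ
bit-idempotent (inj₁ refl) = refl
bit-idempotent (inj₂ refl) = refl

xor-bit : ∀ {a r} → Bit a → Bit r → Bit (a + sgn a * r)
xor-bit (inj₁ refl) (inj₁ refl) = inj₁ refl
xor-bit (inj₁ refl) (inj₂ refl) = inj₂ refl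
xor-bit (inj₂ refl) (inj₁ refl) = inj₂ refl
xor-bit (inj₂ refl) (inj₂ refl) = inj₁ refl

sgn-trit : ∀ {a} → Bit a → Trit (sgn a)
sgn-trit (inj₁ refl) = inj₂ (inj₂ refl)
sgn-trit (inj₂ refl) = inj₁ refl

sgn*trit : ∀ {a t} → Bit a → Trit t → Trit (sgn a * t)
sgn*trit (inj₁ refl) (inj₁ refl)        = inj₁ refl
sgn*trit (inj₁ refl) (inj₂ (inj₁ refl)) = inj₂ (inj₁ refl)
sgn*trit (inj₁ refl) (inj₂ (inj₂ refl)) = inj₂ (inj₂ refl)
sgn*trit (inj₂ refl) (inj₁ refl)        = inj₂ (inj₂ refl)
sgn*trit (inj₂ refl) (inj₂ (inj₁ refl)) = inj₂ (inj₁ refl)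
sgn*trit (inj₂ refl) (inj₂ (inj₂ refl)) = inj₁ refl

zeroOr≥1-+bit : ∀ {s a} → ZeroOr≥1 s → Bit a → ZeroOr≥1 (s + a)
zeroOr≥1-+bit {s} s≡0⊎1≤s (inj₁ refl) = subst ZeroOr≥1 (sym (+-identityʳ s)) s≡0⊎1≤s
zeroOr≥1-+bit (inj₁ refl) (inj₂ refl) = inj₂ ≤-refl
zeroOr≥1-+bit {s} (inj₂ 1≤s) (inj₂ refl) = inj₂ (≤-trans 1≤s s≤s+1)
  where s≤s+1 = subst (_≤ s + 1ℚ) (+-identityʳ s) (+-monoʳ-≤ s (toWitness {a? = 0ℚ ≤? 1ℚ} _))

zeroOr≥1-1-bit+ : ∀ {a s} → Bit a → ZeroOr≥1 s → ZeroOr≥1 (1ℚ - a + s)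
zeroOr≥1-1-bit+ {s = s} (inj₂ refl) s≡0⊎1≤s = subst ZeroOr≥1 (sym (+-identityˡ s)) s≡0⊎1≤s
zeroOr≥1-1-bit+ {s = s} (inj₁ refl) s≡0⊎1≤s = inj₂ (subst (_≤ 1ℚ + s) (+-identityʳ 1ℚ) (+-monoʳ-≤ 1ℚ (nonNeg s≡0⊎1≤s)))
  where
  nonNeg : ZeroOr≥1 s → 0ℚ ≤ s
  nonNeg (inj₁ refl) = ≤-refl
  nonNeg (inj₂ 1≤s)  = ≤-trans (toWitness {a? = 0ℚ ≤? 1ℚ} _) 1≤s

zeroOr≥1-not≥1 : ∀ {q} → ZeroOr≥1 q → ¬ (1ℚ ≤ q) → q ≡ 0ℚ
zeroOr≥1-not≥1 (inj₁ q≡0)  _  = q≡0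
zeroOr≥1-not≥1 (inj₂ 1≤q) 1≰q = ⊥-elim (1≰q 1≤q)

infix 4 ∣_∣<_
∣_∣<_ : ℚ → ℚ → Set
∣ s ∣< c = - c < s × s < c

-- the induction step of |Σ_{i ≤ m} 2^{i-1} d_i| < 2^m for d_i ∈ {-1, 0, 1}
∣∣<-+trit : ∀ m {s d} → ∣ s ∣< fromℕ (2 ^ m) → Trit d → ∣ s + fromℕ (2 ^ m) * d ∣< fromℕ (2 ^ suc m)
∣∣<-+trit m {s} {d} (-c<s , s<c) d-trit = subst (λ c₂ → ∣ s + c * d ∣< c₂) (sym (fromℕ-2^suc m))
  (subst (_< s + c * d) (sym (neg-distrib-+ c c)) (+-mono-<-≤ -c<s (proj₁ (scaled d-trit))) ,
   +-mono-<-≤ s<c (proj₂ (scaled d-trit)))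
  where
  c = fromℕ (2 ^ m)
  0≤c : 0ℚ ≤ c
  0≤c = fromℕ-nonNeg (2 ^ m)
  -c≤0 : - c ≤ 0ℚ
  -c≤0 = neg-antimono-≤ 0≤c
  scaled : ∀ {t} → Trit t → - c ≤ c * t × c * t ≤ c
  scaled (inj₁ refl) = subst (λ u → - c ≤ u × u ≤ c) (sym c*-1≡-c) (≤-refl , ≤-trans -c≤0 0≤c)
    where c*-1≡-c = trans (sym (neg-distribʳ-* c 1ℚ)) (cong -_ (*-identityʳ c))
  scaled (inj₂ (inj₁ refl)) = subst (λ u → - c ≤ u × u ≤ c) (sym (*-zeroʳ c)) (-c≤0 , 0≤c)
  scaled (inj₂ (inj₂ refl)) = subst (λ u → - c ≤ u × u ≤ c) (sym (*-identityʳ c)) (≤-trans -c≤0 0≤c , ≤-refl)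

module _ {a w c : ℚ} (a-bound : ∣ a ∣< w) (0≤w : 0ℚ ≤ w) (1≤c : 1ℚ ≤ c) where

  private
    w≤w*c : w ≤ w * c
    w≤w*c = subst (_≤ w * c) (*-identityʳ w) (*-monoˡ-≤-nonNeg w {{nonNegative 0≤w}} 1≤c)

  ∣a∣<w⇒a-w*c<0 : a - w * c < 0ℚ
  ∣a∣<w⇒a-w*c<0 = subst (a - w * c <_) (+-inverseʳ (w * c))
    (+-mono-<-≤ (<-≤-trans (proj₂ a-bound) w≤w*c) ≤-refl)

  ∣a∣<w⇒a+w*c>0 : 0ℚ < a - - (w * c)
  ∣a∣<w⇒a+w*c>0 = subst₂ _<_ (+-inverseˡ (w * c)) (cong (λ t → a + t) (sym (⁻¹-involutive +-0-group (w * c))))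
    (+-mono-<-≤ (≤-<-trans (neg-antimono-≤ w≤w*c) (proj₁ a-bound)) ≤-refl)

module _ {n : ℕ} (b : Fin n → Bool) where

  X-bit : ∀ i → Bit (eval (toℚ b) (X i))
  X-bit zero = inj₂ refl
  X-bit (suc j) with j ℕ.<? n
  ... | no _    = inj₁ refl
  ... | yes j<n with b (fromℕ< j<n)
  ...   | true  = inj₂ refl
  ...   | false = inj₁ refl

  αAux-bit : ∀ m i → Bit (eval (toℚ b) (αAux m i))
  αAux-bit zero    i = inj₁ refl
  αAux-bit (suc m) i = xor-bit (X-bit i) (αAux-bit m (suc i))

  β-bump-vanishes : ∀ i → eval (toℚ b) (β-bump i) ≡ 0ℚ
  β-bump-vanishes i = trans (cong (fromℕ (2 ^ i) *_) (bit-idempotent (X-bit i))) (*-zeroʳ (fromℕ (2 ^ i)))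

  ΣX-zeroOr≥1 : ∀ m → ZeroOr≥1 (eval (toℚ b) (ΣX m))
  ΣX-zeroOr≥1 zero    = inj₁ refl
  ΣX-zeroOr≥1 (suc m) = zeroOr≥1-+bit (ΣX-zeroOr≥1 m) (X-bit (suc m))

-- The partial derivative ∂_k F_n

module _ {n : ℕ} (k : Fin n) where

  -- the paper's index of x_k (Fin is 0-based)
  K : ℕ
  K = suc (toℕ k)

  X-free : ∀ {i} → i ≢ K → Free k (X {n} i)
  X-free {zero} i≢K = con _
  X-free {suc j} i≢K with j ℕ.<? n
  ... | yes j<n = var λ eq → i≢K (cong suc (trans (sym (Fin.toℕ-fromℕ< j<n)) (cong toℕ eq)))
  ... | no _    = con _

  αAux-free : ∀ m {i} → K ℕ.< i → Free k (αAux {n} m i)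
  αAux-free zero    K<i = con _
  αAux-free (suc m) K<i = X-free i≢K ⊕ ((con _ ⊕ ⊖ (con _ ⊗ X-free i≢K)) ⊗ αAux-free m (ℕ.m<n⇒m<1+n K<i))
    where i≢K = λ i≡K → ℕ.<-irrefl (sym i≡K) K<i

  ΣX-free : ∀ {m} → m ℕ.< K → Free k (ΣX {n} m)
  ΣX-free {zero}  m<K = con _
  ΣX-free {suc m} m<K = ΣX-free (ℕ.<-trans (ℕ.n<1+n m) m<K) ⊕ X-free (λ m≡K → ℕ.<-irrefl m≡K m<K)

  β-factor-free : Free k (β-factor {n} K)
  β-factor-free = con _ ⊕ ⊖ X-free (λ k≡K → ℕ.<-irrefl k≡K (ℕ.n<1+n (toℕ k))) ⊕ ΣX-free (s≤s (ℕ.m∸n≤m (toℕ k) 1))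

  β-bump-free : ∀ {i} → i ≢ K → Free k (β-bump {n} i)
  β-bump-free i≢K = con _ ⊗ (X-free i≢K ⊕ ⊖ (X-free i≢K ⊗ X-free i≢K))

  ∂-ΣX-free : ∀ m → Free k (∂ k (ΣX {n} m))
  ∂-ΣX-free zero    = con _
  ∂-ΣX-free (suc m) = ∂-ΣX-free m ⊕ ∂-X-free (suc m)

  ∂-β-factor-free : ∀ i → Free k (∂ k (β-factor {n} i))
  ∂-β-factor-free i = con _ ⊕ ⊖ ∂-X-free (i ∸ 1) ⊕ ∂-ΣX-free (i ∸ 2)

  ∂β-pivot-vanishes : ∀ z → eval z (β-factor K) ≡ 0ℚ → eval z (∂ k (β n K)) ≡ 0ℚ
  ∂β-pivot-vanishes z factor≡0 = begin
    eval z (∂ k (β n K))                           ≡⟨ ∂-⊗-freeʳ z {p = β-bump K} β-factor-free ⟩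
    eval z (∂ k (β-bump K)) * eval z (β-factor K)  ≡⟨ cong (eval z (∂ k (β-bump K)) *_) factor≡0 ⟩
    eval z (∂ k (β-bump K)) * 0ℚ                   ≡⟨ *-zeroʳ (eval z (∂ k (β-bump K))) ⟩
    0ℚ                                             ∎
    where open ≡-Reasoning

  module _ {x y : Fin n → ℚ} (x≈y : AgreeOff k x y) where

    ∂-agrees-αAux : ∀ m i → ∂-Agrees k x y (αAux m i)
    ∂-agrees-αAux zero    i = ∂-agrees refl
    ∂-agrees-αAux (suc m) i with i ℕ.≟ K
    ... | yes refl = ∂-agrees-⊕ x≈y (∂-agrees-X x≈y K)
          (∂-agrees-⊗-freeʳ x≈y ∂-agrees-sgn (αAux-free m (ℕ.n<1+n K)))
      where
      ∂-agrees-sgn : ∂-Agrees k x y (cℕ 1 ⊝ cℕ 2 ⊗ X K)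
      ∂-agrees-sgn = ∂-agrees-⊕ x≈y (∂-agrees refl) (∂-agrees-⊖ x≈y (∂-agrees-⊗-freeˡ x≈y (con _) (∂-agrees-X x≈y K)))
    ... | no i≢K = ∂-agrees-⊕ x≈y (∂-agrees-X x≈y i)
          (∂-agrees-⊗-freeˡ x≈y (con _ ⊕ ⊖ (con _ ⊗ X-free i≢K)) (∂-agrees-αAux m (suc i)))

    ∂-agrees-β : eval x (β-factor K) ≡ 0ℚ → ∀ i → ∂-Agrees k x y (β n i)
    ∂-agrees-β factor≡0 i with i ℕ.≟ K
    ... | yes refl = ∂-agrees (trans (∂β-pivot-vanishes x factor≡0)
                       (sym (∂β-pivot-vanishes y (trans (sym (eval-free x≈y β-factor-free)) factor≡0))))
    ... | no i≢K   = ∂-agrees-⊗-freeˡ x≈y (β-bump-free i≢K) (∂-agrees (eval-free x≈y (∂-β-factor-free i)))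

    ∂-agrees-FSum : eval x (β-factor K) ≡ 0ℚ → ∀ m → ∂-Agrees k x y (FSum n m)
    ∂-agrees-FSum factor≡0 zero    = ∂-agrees refl
    ∂-agrees-FSum factor≡0 (suc m) = ∂-agrees-⊕ x≈y (∂-agrees-FSum factor≡0 m)
      (∂-agrees-⊕ x≈y (∂-agrees-⊗-freeˡ x≈y (con _) (∂-agrees-αAux _ _))
                      (∂-agrees-⊖ x≈y (∂-agrees-β factor≡0 (suc m))))

    ∂F-agrees : eval x (β-factor K) ≡ 0ℚ → ∂F n k x ≡ ∂F n k y
    ∂F-agrees factor≡0 = ∂-agreement (∂-agrees-FSum factor≡0 n)

  ∂X-pivot : ∀ z → eval z (∂ k (X K)) ≡ 1ℚ
  ∂X-pivot z with toℕ k ℕ.<? n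
  ... | no k≮n = ⊥-elim (k≮n (Fin.toℕ<n k))
  ... | yes k<n with fromℕ< k<n Fin.≟ k
  ...   | yes _ = refl
  ...   | no k≢k = ⊥-elim (k≢k (Fin.fromℕ<-toℕ k k<n))

  X-pivot : ∀ b → eval (toℚ b) (X K) ≡ toℚ b k
  X-pivot b with toℕ k ℕ.<? n
  ... | yes k<n = cong (toℚ b) (Fin.fromℕ<-toℕ k k<n)
  ... | no k≮n  = ⊥-elim (k≮n (Fin.toℕ<n k))

  ∂αAux-suc : ∀ z m i →
    eval z (∂ k (αAux (suc m) i)) ≡
    eval z (∂ k (X i)) * sgn (eval z (αAux m (suc i))) + sgn (eval z (X i)) * eval z (∂ k (αAux m (suc i)))
  ∂αAux-suc z m i = solve 4 (λ dx x r dr →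
      dx :+ ((con 0ℚ :+ :- (con 0ℚ :* x :+ con (fromℕ 2) :* dx)) :* r :+ (con 1ℚ :- con (fromℕ 2) :* x) :* dr)
    := dx :* (con 1ℚ :- con (fromℕ 2) :* r) :+ (con 1ℚ :- con (fromℕ 2) :* x) :* dr)
    refl (eval z (∂ k (X i))) (eval z (X i)) (eval z (αAux m (suc i))) (eval z (∂ k (αAux m (suc i))))
    where open +-*-Solver

  ∂β-bump : ∀ z i → eval z (∂ k (β-bump i)) ≡ fromℕ (2 ^ i) * (eval z (∂ k (X i)) * sgn (eval z (X i)))
  ∂β-bump z i = solve 3 (λ c dx x →
      con 0ℚ :* (x :- x :* x) :+ c :* (dx :- (dx :* x :+ x :* dx))
    := c :* (dx :* (con 1ℚ :- con (fromℕ 2) :* x)))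
    refl (fromℕ (2 ^ i)) (eval z (∂ k (X i))) (eval z (X i))
    where open +-*-Solver

  ∂FSum-suc : ∀ z m → eval z (∂ k (FSum n (suc m))) ≡
    eval z (∂ k (FSum n m)) + (fromℕ (2 ^ m) * eval z (∂ k (α n (suc m))) - eval z (∂ k (β n (suc m))))
  ∂FSum-suc z m = cong (λ t → eval z (∂ k (FSum n m)) + (t - eval z (∂ k (β n (suc m)))))
    (∂-⊗-freeˡ z {q = α n (suc m)} (con (fromℕ (2 ^ m))))

  module _ (b : Fin n → Bool) where

    private
      x = toℚ b
      S : ℕ → ℚ
      S m = eval x (∂ k (FSum n m))
      w = fromℕ (2 ^ K)
      0≤w = fromℕ-nonNeg (2 ^ K)
      c = eval x (β-factor K)
      open ≡-Reasoning

    ∂αAux-trit : ∀ m i → Trit (eval x (∂ k (αAux m i)))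
    ∂αAux-trit zero    i = inj₂ (inj₁ refl)
    ∂αAux-trit (suc m) i with i ℕ.≟ K
    ... | yes refl = subst Trit (sym (begin
      eval x (∂ k (αAux (suc m) K))       ≡⟨ ∂αAux-suc x m K ⟩
      dx * sgn r + sgn a * dr              ≡⟨ cong₂ (λ u v → u * sgn r + sgn a * v) (∂X-pivot x) (∂-free x (αAux-free m (ℕ.n<1+n K))) ⟩
      1ℚ * sgn r + sgn a * 0ℚ              ≡⟨ cong₂ _+_ (*-identityˡ (sgn r)) (*-zeroʳ (sgn a)) ⟩
      sgn r + 0ℚ                           ≡⟨ +-identityʳ (sgn r) ⟩
      sgn r                                ∎)) (sgn-trit (αAux-bit b m (suc K)))
      where
      a = eval x (X K)
      dx = eval x (∂ k (X K))
      r = eval x (αAux m (suc K))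
      dr = eval x (∂ k (αAux m (suc K)))
    ... | no i≢K = subst Trit (sym (begin
      eval x (∂ k (αAux (suc m) i))       ≡⟨ ∂αAux-suc x m i ⟩
      dx * sgn r + sgn a * dr              ≡⟨ cong (λ u → u * sgn r + sgn a * dr) (∂-free x (X-free i≢K)) ⟩
      0ℚ * sgn r + sgn a * dr              ≡⟨ cong (_+ sgn a * dr) (*-zeroˡ (sgn r)) ⟩
      0ℚ + sgn a * dr                      ≡⟨ +-identityˡ (sgn a * dr) ⟩
      sgn a * dr                           ∎)) (sgn*trit (X-bit b i) (∂αAux-trit m (suc i)))
      where
      a = eval x (X i)
      dx = eval x (∂ k (X i))
      r = eval x (αAux m (suc i))
      dr = eval x (∂ k (αAux m (suc i)))

    ∂β-off-pivot : ∀ {i} → i ≢ K → eval x (∂ k (β n i)) ≡ 0ℚ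
    ∂β-off-pivot {i} i≢K = cong₂ _+_
      (trans (cong (_* eval x (β-factor i)) (∂-free x (β-bump-free i≢K))) (*-zeroˡ (eval x (β-factor i))))
      (trans (cong (_* eval x (∂ k (β-factor i))) (β-bump-vanishes b i)) (*-zeroˡ (eval x (∂ k (β-factor i)))))

    ∂FSum-off-pivot : ∀ m → suc m ≢ K → S (suc m) ≡ S m + fromℕ (2 ^ m) * eval x (∂ k (α n (suc m)))
    ∂FSum-off-pivot m sm≢K = begin
      S (suc m)              ≡⟨ ∂FSum-suc x m ⟩
      S m + (wₘ * dα - dβ)    ≡⟨ cong (λ t → S m + (wₘ * dα - t)) (∂β-off-pivot sm≢K) ⟩
      S m + (wₘ * dα - 0ℚ)    ≡⟨ cong (λ t → S m + t) (+-identityʳ (wₘ * dα)) ⟩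
      S m + wₘ * dα           ∎
      where
      wₘ = fromℕ (2 ^ m)
      dα = eval x (∂ k (α n (suc m)))
      dβ = eval x (∂ k (β n (suc m)))

    ∂FSum-below-pivot : ∀ m → m ℕ.≤ toℕ k → ∣ S m ∣< fromℕ (2 ^ m)
    ∂FSum-below-pivot zero    _     = toWitness {a? = - 1ℚ <? 0ℚ} _ , toWitness {a? = 0ℚ <? 1ℚ} _
    ∂FSum-below-pivot (suc m) sm≤k = subst (λ t → ∣ t ∣< fromℕ (2 ^ suc m))
      (sym (∂FSum-off-pivot m (λ sm≡K → ℕ.<-irrefl sm≡K (s≤s sm≤k))))
      (∣∣<-+trit m (∂FSum-below-pivot m (ℕ.<⇒≤ sm≤k)) (∂αAux-trit (suc n ∸ suc m) (suc m)))

    ∂FSum-above-pivot : ∀ d → S (K ℕ.+ d) ≡ S K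
    ∂FSum-above-pivot zero    = cong S (ℕ.+-identityʳ K)
    ∂FSum-above-pivot (suc d) = begin
      S (K ℕ.+ suc d)                                ≡⟨ cong S (ℕ.+-suc K d) ⟩
      S (suc (K ℕ.+ d))                              ≡⟨ ∂FSum-off-pivot (K ℕ.+ d) K+d+1≢K ⟩
      S (K ℕ.+ d) + wₘ * eval x (∂ k (α n (suc (K ℕ.+ d)))) ≡⟨ cong (λ t → S (K ℕ.+ d) + wₘ * t) ∂α≡0 ⟩
      S (K ℕ.+ d) + wₘ * 0ℚ                           ≡⟨ cong (λ t → S (K ℕ.+ d) + t) (*-zeroʳ wₘ) ⟩
      S (K ℕ.+ d) + 0ℚ                               ≡⟨ +-identityʳ (S (K ℕ.+ d)) ⟩
      S (K ℕ.+ d)                                    ≡⟨ ∂FSum-above-pivot d ⟩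
      S K                                            ∎
      where
      wₘ = fromℕ (2 ^ (K ℕ.+ d))
      K<K+d+1 : K ℕ.< suc (K ℕ.+ d)
      K<K+d+1 = s≤s (ℕ.m≤m+n K d)
      K+d+1≢K = λ eq → ℕ.<-irrefl (sym eq) K<K+d+1
      ∂α≡0 = ∂-free x (αAux-free (n ∸ (K ℕ.+ d)) K<K+d+1)

    ∂α-sum : ℚ
    ∂α-sum = S (toℕ k) + fromℕ (2 ^ toℕ k) * eval x (∂ k (α n K))

    ∂α-sum-bound : ∣ ∂α-sum ∣< fromℕ (2 ^ K)
    ∂α-sum-bound = ∣∣<-+trit (toℕ k) (∂FSum-below-pivot (toℕ k) ℕ.≤-refl) (∂αAux-trit (n ∸ toℕ k) K)

    ∂F-split : ∂F n k x ≡ ∂α-sum - eval x (∂ k (β n K))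
    ∂F-split = begin
      S n                          ≡⟨ cong S (sym (ℕ.m+[n∸m]≡n (Fin.toℕ<n k))) ⟩
      S (K ℕ.+ (n ∸ K))            ≡⟨ ∂FSum-above-pivot (n ∸ K) ⟩
      S K                          ≡⟨ ∂FSum-suc x (toℕ k) ⟩
      S (toℕ k) + (wₘ * dα - dβ)   ≡⟨ +-assoc (S (toℕ k)) (wₘ * dα) (- dβ) ⟨
      S (toℕ k) + wₘ * dα - dβ     ∎
      where
      wₘ = fromℕ (2 ^ toℕ k)
      dα = eval x (∂ k (α n K))
      dβ = eval x (∂ k (β n K))

    ∂β-pivot : eval x (∂ k (β n K)) ≡ fromℕ (2 ^ K) * sgn (toℚ b k) * eval x (β-factor K)
    ∂β-pivot = begin
      eval x (∂ k (β n K))                               ≡⟨ ∂-⊗-freeʳ x {p = β-bump K} β-factor-free ⟩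
      eval x (∂ k (β-bump K)) * c                        ≡⟨ cong (_* c) (∂β-bump x K) ⟩
      w * (eval x (∂ k (X K)) * sgn (eval x (X K))) * c  ≡⟨ cong₂ (λ u v → w * (u * sgn v) * c) (∂X-pivot x) (X-pivot b) ⟩
      w * (1ℚ * sgn (toℚ b k)) * c                       ≡⟨ cong (λ t → w * t * c) (*-identityˡ (sgn (toℚ b k))) ⟩
      w * sgn (toℚ b k) * c                              ∎

    β-factor-zeroOr≥1 : ZeroOr≥1 (eval x (β-factor K))
    β-factor-zeroOr≥1 = zeroOr≥1-1-bit+ (X-bit b (toℕ k)) (ΣX-zeroOr≥1 b (toℕ k ∸ 1))

    ∂F<0 : 1ℚ ≤ c → b k ≡ false → ∂F n k x < 0ℚ
    ∂F<0 1≤c bk≡false = subst (_< 0ℚ) (sym ∂F≡) (∣a∣<w⇒a-w*c<0 ∂α-sum-bound 0≤w 1≤c)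
      where
      ∂F≡ : ∂F n k x ≡ ∂α-sum - w * c
      ∂F≡ = begin
        ∂F n k x                         ≡⟨ ∂F-split ⟩
        ∂α-sum - eval x (∂ k (β n K))    ≡⟨ cong (λ t → ∂α-sum - t) ∂β-pivot ⟩
        ∂α-sum - w * sgn (toℚ b k) * c   ≡⟨ cong (λ v → ∂α-sum - w * sgn (if v then 1ℚ else 0ℚ) * c) bk≡false ⟩
        ∂α-sum - w * 1ℚ * c              ≡⟨ cong (λ t → ∂α-sum - t * c) (*-identityʳ w) ⟩
        ∂α-sum - w * c                   ∎

    ∂F>0 : 1ℚ ≤ c → b k ≡ true → ∂F n k x > 0ℚ
    ∂F>0 1≤c bk≡true = subst (0ℚ <_) (sym ∂F≡) (∣a∣<w⇒a+w*c>0 ∂α-sum-bound 0≤w 1≤c)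
      where
      ∂F≡ : ∂F n k x ≡ ∂α-sum - - (w * c)
      ∂F≡ = begin
        ∂F n k x                         ≡⟨ ∂F-split ⟩
        ∂α-sum - eval x (∂ k (β n K))    ≡⟨ cong (λ t → ∂α-sum - t) ∂β-pivot ⟩
        ∂α-sum - w * sgn (toℚ b k) * c   ≡⟨ cong (λ v → ∂α-sum - w * sgn (if v then 1ℚ else 0ℚ) * c) bk≡true ⟩
        ∂α-sum - w * - 1ℚ * c            ≡⟨ cong (λ t → ∂α-sum - t * c) (neg-distribʳ-* w 1ℚ) ⟨
        ∂α-sum - - (w * 1ℚ) * c          ≡⟨ cong (λ t → ∂α-sum - - t * c) (*-identityʳ w) ⟩
        ∂α-sum - - w * c                 ≡⟨ cong (λ t → ∂α-sum - t) (neg-distribˡ-* w c) ⟨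
        ∂α-sum - - (w * c)               ∎

    β-factor-vanishes : (∂F n k x > 0ℚ × b k ≡ false) ⊎ (∂F n k x < 0ℚ × b k ≡ true) → c ≡ 0ℚ
    β-factor-vanishes (inj₁ (∂F>0 , bk≡false)) =
      zeroOr≥1-not≥1 β-factor-zeroOr≥1 (λ 1≤c → <-asym ∂F>0 (∂F<0 1≤c bk≡false))
    β-factor-vanishes (inj₂ (∂F<0 , bk≡true)) =
      zeroOr≥1-not≥1 β-factor-zeroOr≥1 (λ 1≤c → <-asym ∂F<0 (∂F>0 1≤c bk≡true))

proposition3 : (n : ℕ) (b : Fin n → Bool) →
    ¬ (∀ j → b j ≡ eLastBool n j) →
    (k : Fin n) →
    ((∂F n k (toℚ b) > 0ℚ × b k ≡ false) ⊎ (∂F n k (toℚ b) < 0ℚ × b k ≡ true)) →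
    (μ : ℚ) →
    ∂F n k (toℚ b) ≡ ∂F n k (λ j → toℚ b j + μ * unit k j)
-- The hypothesis x ≠ e^n only serves the existence of k.
proposition3 n b _ k hyp μ = ∂F-agrees k (agreeOff-+unit k (toℚ b) μ) (β-factor-vanishes k b hyp)
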